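{- Let $G$ be an abelian group of order $v$, and let $m>1$ and $k\ge 1$ be integers. A non-disjoint $(v,m,k,1)$-SEDF exists in $G$ if and only if $m=2$ and $v=k^2$.
   Context: Groups are written additively. For subsets $A,B$ of $G$, $\Delta(A,B)$ denotes the multiset $\{a-b: a\in A, b\in B\}$. A family of $k$-subsets $\{A_1,\ldots,A_m\}$ of $G$ (with $m>1$) is a non-disjoint $(v,m,k,\lambda)$-SEDF if for each $1\le i\le m$ the multiset union $\bigcup_{j\neq i}\Delta(A_i,A_j)$ contains every element of $G$ (including $0$) exactly $\lambda$ times. -}

module Defs where

open import Data.Nat using (ℕ; zero; suc; _+_; _*_)
open import Data.Fin using (Fin) renaming (_≟_ to _≟ᶠ_)
open import Data.Fin.Subset using (Subset; ∣_∣)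
open import Data.Fin.Subset.Properties using (_∈?_)
open import Data.List using (List; map; allFin)
open import Data.Nat.ListAction using (sum)
open import Data.Product using (Σ; _×_)
open import Relation.Nullary using (yes; no)
open import Relation.Binary.PropositionalEquality using (_≡_)

sumFin : (n : ℕ) → (Fin n → ℕ) → ℕ
sumFin n f = sum (map f (allFin n))

-- Multiplicity of g in the multiset ⋃_{j ≠ i} Δ(A_i, A_j),
-- where Δ(A,B) = {a - b : a ∈ A, b ∈ B}.
multiplicity : {v m : ℕ} → (Fin v → Fin v → Fin v) → (Fin v → Fin v) →
               (Fin m → Subset v) → Fin m → Fin v → ℕ
multiplicity {v} {m} _⊕_ ⊖_ A i g =
  sumFin m λ j → case-ne j
  where
  count-ab : Fin m → ℕ
  count-ab j = sumFin v λ a → sumFin v λ b → indicator a b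
    where
    indicator : Fin v → Fin v → ℕ
    indicator a b with a ∈? A i | b ∈? A j | (a ⊕ (⊖ b)) ≟ᶠ g
    ... | yes _ | yes _ | yes _ = 1
    ... | _     | _     | _     = 0
  case-ne : Fin m → ℕ
  case-ne j with j ≟ᶠ i
  ... | yes _ = 0
  ... | no  _ = count-ab j

IsNonDisjointSEDF : (v m k λ' : ℕ) → (Fin v → Fin v → Fin v) → (Fin v → Fin v) →
                    (Fin m → Subset v) → Set
IsNonDisjointSEDF v m k λ' _⊕_ ⊖_ A =
  ((i : Fin m) → ∣ A i ∣ ≡ k) ×
  ((i : Fin m) (g : Fin v) → multiplicity _⊕_ ⊖_ A i g ≡ λ')

NonDisjointSEDFExists : (v m k λ' : ℕ) → (Fin v → Fin v → Fin v) → (Fin v → Fin v) → Set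
NonDisjointSEDFExists v m k λ' _⊕_ ⊖_ =
  Σ (Fin m → Subset v) (IsNonDisjointSEDF v m k λ' _⊕_ ⊖_)

-- The element 0 is represented exactly once in ⋃_{j≠i} Δ(A_i, A_j), so every A_l
-- meets some other A_j. If y ∈ A_l ∩ A_j and there were a third index i, then for a ∈ A_i the
-- difference a - y would occur in both Δ(A_i, A_l) and Δ(A_i, A_j). Hence m = 2, and since
-- Δ(A_1, A_2) covers G exactly once, v = k².
--
-- For every d ∣ |G| the group factorises as G = A ⊕ B (each element uniquely
-- a + b) with |A| = d; for d = k the pair {A, -B} is the required SEDF. The factorisation is
-- built along a chain 0 = H₀ ⊂ H₁ ⊂ ⋯ ⊂ G with H_{i+1} = H_i ⊕ {0, g, …, (r-1)g}, r the order
-- of g modulo H_i: a divisor of |H_i| r splits as d' s with d' ∣ |H_i| and s t = r, and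
-- {0, g, …, (r-1)g} = {0, g, …, (s-1)g} ⊕ {0, sg, …, (t-1)sg}.
-- Multisets on G are ℕ-valued functions and ⊕ of multisets is the convolution _⋆_.

module Submission where

open import Algebra.Bundles using (AbelianGroup)
open import Algebra.Structures using (IsAbelianGroup)
open import Data.Bool using (true; false; if_then_else_)
open import Data.Empty using (⊥; ⊥-elim)
open import Data.Fin using (Fin; zero; suc; toℕ; fromℕ<; _↑ˡ_; _↑ʳ_; combine) renaming (_≟_ to _≟ᶠ_)
open import Data.Fin.Permutation using (permutation)
open import Data.Fin.Properties using (toℕ-combine; toℕ-fromℕ<; toℕ<n; pigeonhole)
  renaming (<-cmp to <-cmpᶠ; suc-injective to fsuc-injective)
open import Data.Fin.Subset using (Subset; _∈_; ∣_∣)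
open import Data.Fin.Subset.Properties using (_∈?_)
open import Data.List as List using (List; []; _∷_; allFin)
open import Data.List.Membership.Propositional.Properties using (∈-allFin)
open import Data.List.Properties using (map-tabulate)
open import Data.List.Relation.Unary.All as All using (All; []; _∷_)
open import Data.Nat using (ℕ; zero; suc; _+_; _*_; _∸_; _≤_; _<_; z≤n; s≤s; s≤s⁻¹; _/_; _%_; _≟_; _≤?_; _≡ᵇ_;
  NonZero; ≢-nonZero; >-nonZero; >-nonZero⁻¹)
open import Data.Nat.Coprimality using (coprime-/gcd; coprime-divisor)
open import Data.Nat.Divisibility using (_∣_; divides; *-cancelʳ-∣; ∣1⇒≡1)
open import Data.Nat.DivMod using (m/n*n≡m; m%n<n; m≡m%n+[m/n]*n)
open import Data.Nat.GCD using (gcd; gcd[m,n]∣m; gcd[m,n]∣n; gcd[m,n]≢0)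
open import Data.Nat.ListAction using () renaming (sum to sumˡ)
open import Data.Nat.Properties
open import Data.Product using (Σ; ∃; ∃₂; _×_; _,_; proj₁; proj₂)
open import Data.Sum using (_⊎_; inj₁; inj₂; [_,_]′)
open import Data.Vec using ([]; _∷_; tabulate)
open import Function using (_∘_; id; case_of_)
open import Function.Bundles using (_⇔_; mk⇔)
open import Relation.Binary.Definitions using (tri<; tri≈; tri>)
open import Relation.Binary.PropositionalEquality
open import Relation.Nullary using (Dec; does; yes; no; ¬_; _×-dec_; contradiction)
open import Relation.Unary using (Decidable)
open import Defs

import Algebra.Properties.AbelianGroup as AbelianGroupProperties
import Algebra.Properties.CommutativeSemigroup as CommutativeSemigroupProperties
import Algebra.Properties.Monoid.Mult as MonoidMultiplication
open import Algebra.Properties.Semiring.Sum +-*-semiring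
  using (sum; sum-cong-≋; sum-replicate-zero; ∑-comm; ∑-permute; *-distribˡ-sum; *-distribʳ-sum)
open CommutativeSemigroupProperties *-commutativeSemigroup using () renaming (x∙yz≈y∙xz to x*[y*z]≡y*[x*z])

-- Indicators and finite sums

𝟙 : ∀ {p} {P : Set p} → Dec P → ℕ
𝟙 d = if does d then 1 else 0

module _ {p} {P : Set p} where

  𝟙-yes : (d : Dec P) → P → 𝟙 d ≡ 1
  𝟙-yes (yes _) _  = refl
  𝟙-yes (no ¬p) p  = ⊥-elim (¬p p)

  𝟙-no : (d : Dec P) → ¬ P → 𝟙 d ≡ 0
  𝟙-no (yes p) ¬p = ⊥-elim (¬p p)
  𝟙-no (no _)  _  = refl

  𝟙≤1 : (d : Dec P) → 𝟙 d ≤ 1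
  𝟙≤1 (yes _) = s≤s z≤n
  𝟙≤1 (no _)  = z≤n

  𝟙-positive : (d : Dec P) → 1 ≤ 𝟙 d → P
  𝟙-positive (yes p) _ = p

𝟙-cong : ∀ {p q} {P : Set p} {Q : Set q} (d : Dec P) (e : Dec Q) → (P → Q) → (Q → P) → 𝟙 d ≡ 𝟙 e
𝟙-cong (yes p) e f g = sym (𝟙-yes e (f p))
𝟙-cong (no ¬p) e f g = sym (𝟙-no e (¬p ∘ g))

δ : ∀ {n} → Fin n → Fin n → ℕ
δ x y = 𝟙 (x ≟ᶠ y)

δ-refl : ∀ {n} (x : Fin n) → δ x x ≡ 1
δ-refl x = 𝟙-yes (x ≟ᶠ x) refl

δ-≢ : ∀ {n} {x y : Fin n} → x ≢ y → δ x y ≡ 0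
δ-≢ {x = x} {y} = 𝟙-no (x ≟ᶠ y)

δ≡1⇒≡ : ∀ {n} {x y : Fin n} → δ x y ≡ 1 → x ≡ y
δ≡1⇒≡ {x = x} {y} δ≡1 = 𝟙-positive (x ≟ᶠ y) (≤-reflexive (sym δ≡1))

δ-sym : ∀ {n} (x y : Fin n) → δ x y ≡ δ y x
δ-sym x y = 𝟙-cong (x ≟ᶠ y) (y ≟ᶠ x) sym sym

sumFin≡∑ : ∀ n (f : Fin n → ℕ) → sumFin n f ≡ sum f
sumFin≡∑ n f = trans (cong sumˡ (map-tabulate id f)) (tabulate-sum n f)
  where
  tabulate-sum : ∀ n (f : Fin n → ℕ) → sumˡ (List.tabulate f) ≡ sum f
  tabulate-sum zero    f = refl
  tabulate-sum (suc n) f = cong (f zero +_) (tabulate-sum n (f ∘ suc))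

∑-one : ∀ n → sum {n} (λ _ → 1) ≡ n
∑-one zero    = refl
∑-one (suc n) = cong suc (∑-one n)

∑-zero : ∀ {n} {f : Fin n → ℕ} → (∀ i → f i ≡ 0) → sum f ≡ 0
∑-zero {n} f≡0 = trans (sum-cong-≋ f≡0) (sum-replicate-zero n)

∑-*ˡ : ∀ {n} c (f : Fin n → ℕ) → sum (λ i → c * f i) ≡ c * sum f
∑-*ˡ c f = sym (*-distribˡ-sum c f)

∑-*ʳ : ∀ {n} c (f : Fin n → ℕ) → sum (λ i → f i * c) ≡ sum f * c
∑-*ʳ c f = sym (*-distribʳ-sum c f)

∑-δ : ∀ {n} (z : Fin n) (F : Fin n → ℕ) → sum (λ x → δ z x * F x) ≡ F z
∑-δ {suc n} zero F = begin
  F zero + 0 + sum (λ x → δ zero (suc x) * F (suc x)) ≡⟨ cong (F zero + 0 +_) (∑-zero λ x → cong (_* F (suc x)) (δ-≢ {x = zero} {suc x} λ ())) ⟩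
  F zero + 0 + 0                                        ≡⟨ trans (+-identityʳ _) (+-identityʳ _) ⟩
  F zero                                                ∎
  where open ≡-Reasoning
∑-δ {suc n} (suc z) F =
  cong₂ _+_ (cong (_* F zero) (δ-≢ {x = suc z} {zero} λ ()))
            (trans (sum-cong-≋ λ x → cong (_* F (suc x)) (𝟙-cong (suc z ≟ᶠ suc x) (z ≟ᶠ x) fsuc-injective (cong suc)))
                   (∑-δ z (F ∘ suc)))

∑-δʳ : ∀ {n} (z : Fin n) (F : Fin n → ℕ) → sum (λ x → F x * δ x z) ≡ F z
∑-δʳ z F = trans (sum-cong-≋ λ x → trans (*-comm (F x) _) (cong (_* F x) (δ-sym x z))) (∑-δ z F)

∑-δ-one : ∀ {n} (z : Fin n) → sum (δ z) ≡ 1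
∑-δ-one z = trans (sum-cong-≋ λ x → sym (*-identityʳ (δ z x))) (∑-δ z (λ _ → 1))

term≤∑ : ∀ {n} (f : Fin n → ℕ) (i : Fin n) → f i ≤ sum f
term≤∑ f zero    = m≤m+n (f zero) _
term≤∑ f (suc i) = ≤-trans (term≤∑ (f ∘ suc) i) (m≤n+m _ (f zero))

terms≤∑ : ∀ {n} (f : Fin n → ℕ) {i j : Fin n} → i ≢ j → f i + f j ≤ sum f
terms≤∑ f {zero}  {zero}  i≢j = ⊥-elim (i≢j refl)
terms≤∑ f {zero}  {suc j} _   = +-monoʳ-≤ (f zero) (term≤∑ (f ∘ suc) j)
terms≤∑ f {suc i} {zero}  _   = subst (_≤ sum f) (+-comm (f zero) (f (suc i))) (+-monoʳ-≤ (f zero) (term≤∑ (f ∘ suc) i))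
terms≤∑ f {suc i} {suc j} i≢j = ≤-trans (terms≤∑ (f ∘ suc) (i≢j ∘ cong suc)) (m≤n+m _ (f zero))

positive-term : ∀ {n} (f : Fin n → ℕ) → 1 ≤ sum f → ∃ λ i → 1 ≤ f i
positive-term {suc n} f 1≤∑ with f zero in eq
... | suc _ = zero , subst (1 ≤_) (sym eq) (s≤s z≤n)
... | zero  = let i , 1≤fi = positive-term (f ∘ suc) 1≤∑ in suc i , 1≤fi

∑≤1 : ∀ {n} (f : Fin n → ℕ) → (∀ i → f i ≤ 1) → (∀ i j → f i ≡ 1 → f j ≡ 1 → i ≡ j) → sum f ≤ 1
∑≤1 {zero}  f _   _      = z≤n
∑≤1 {suc n} f f≤1 unique with n≤1⇒n≡0∨n≡1 (f≤1 zero)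
... | inj₁ f₀≡0 rewrite f₀≡0 = ∑≤1 (f ∘ suc) (f≤1 ∘ suc) λ i j fi fj → fsuc-injective (unique (suc i) (suc j) fi fj)
... | inj₂ f₀≡1 rewrite f₀≡1 = ≤-reflexive (cong suc (∑-zero rest≡0))
  where
  rest≡0 : ∀ i → f (suc i) ≡ 0
  rest≡0 i with n≤1⇒n≡0∨n≡1 (f≤1 (suc i))
  ... | inj₁ fᵢ≡0 = fᵢ≡0
  ... | inj₂ fᵢ≡1 = case unique zero (suc i) f₀≡1 fᵢ≡1 of λ ()

∑-↑ : ∀ m {n} (f : Fin (m + n) → ℕ) → sum f ≡ sum (f ∘ (_↑ˡ n)) + sum (f ∘ (m ↑ʳ_))
∑-↑ zero    f = refl
∑-↑ (suc m) f = trans (cong (f zero +_) (∑-↑ m (f ∘ suc))) (sym (+-assoc (f zero) _ _))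

∑-combine : ∀ m {n} (f : Fin (m * n) → ℕ) → sum f ≡ sum (λ i → sum (λ j → f (combine {m} {n} i j)))
∑-combine zero        f = refl
∑-combine (suc m) {n} f = trans (∑-↑ n f) (cong (sum (f ∘ (_↑ˡ m * n)) +_) (∑-combine m (f ∘ (n ↑ʳ_))))

∑-weighted-swap : ∀ {m n} (g : Fin m → ℕ) (φ : Fin m → Fin n → ℕ) (K : Fin n → ℕ) →
                  sum (λ y → sum (λ b → g b * φ b y) * K y) ≡ sum (λ b → g b * sum (λ y → φ b y * K y))
∑-weighted-swap g φ K = begin
  sum (λ y → sum (λ b → g b * φ b y) * K y)   ≡⟨ sum-cong-≋ (λ y → sym (∑-*ʳ (K y) (λ b → g b * φ b y))) ⟩
  sum (λ y → sum (λ b → g b * φ b y * K y))   ≡⟨ ∑-comm (λ y b → g b * φ b y * K y) ⟩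
  sum (λ b → sum (λ y → g b * φ b y * K y))   ≡⟨ sum-cong-≋ (λ b → trans (sum-cong-≋ λ y → *-assoc (g b) (φ b y) (K y)) (∑-*ˡ (g b) (λ y → φ b y * K y))) ⟩
  sum (λ b → g b * sum (λ y → φ b y * K y))   ∎
  where open ≡-Reasoning

𝟙ˢ : ∀ {n} → Subset n → Fin n → ℕ
𝟙ˢ S x = 𝟙 (x ∈? S)

∣S∣≡∑𝟙ˢ : ∀ {n} (S : Subset n) → ∣ S ∣ ≡ sum (𝟙ˢ S)
∣S∣≡∑𝟙ˢ []          = refl
∣S∣≡∑𝟙ˢ (true ∷ S)  = cong suc (∣S∣≡∑𝟙ˢ S)
∣S∣≡∑𝟙ˢ (false ∷ S) = ∣S∣≡∑𝟙ˢ S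

nonempty : ∀ {n} (S : Subset n) → 1 ≤ ∣ S ∣ → ∃ λ x → x ∈ S
nonempty S 1≤∣S∣ = let x , 1≤𝟙 = positive-term (𝟙ˢ S) (subst (1 ≤_) (∣S∣≡∑𝟙ˢ S) 1≤∣S∣) in x , 𝟙-positive (x ∈? S) 1≤𝟙

support : ∀ {n} → (Fin n → ℕ) → Subset n
support F = tabulate λ x → F x ≡ᵇ 1

𝟙ˢ-support : ∀ {n} (F : Fin n → ℕ) → (∀ x → F x ≤ 1) → 𝟙ˢ (support F) ≗ F
𝟙ˢ-support F F≤1 zero with F zero | F≤1 zero
... | zero  | _ = refl
... | suc zero | _ = refl
... | suc (suc _) | s≤s ()
𝟙ˢ-support F F≤1 (suc x) = 𝟙ˢ-support (F ∘ suc) (F≤1 ∘ suc) x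

∣support∣ : ∀ {n} (F : Fin n → ℕ) → (∀ x → F x ≤ 1) → ∣ support F ∣ ≡ sum F
∣support∣ F F≤1 = trans (∣S∣≡∑𝟙ˢ (support F)) (sum-cong-≋ (𝟙ˢ-support F F≤1))

1≤m*n⇒1≤m×1≤n : ∀ m n → 1 ≤ m * n → 1 ≤ m × 1 ≤ n
1≤m*n⇒1≤m×1≤n m n 1≤mn = >-nonZero⁻¹ m {{m*n≢0⇒m≢0 m}} , >-nonZero⁻¹ n {{m*n≢0⇒n≢0 m}}
  where instance _ = >-nonZero 1≤mn

least : ∀ {p} {P : ℕ → Set p} → Decidable P → ∀ {n} → P n → ∃ λ r → P r × (∀ {r'} → r' < r → ¬ P r')
least {P = P} P? {n} pn = [ (λ none → ⊥-elim (none ≤-refl pn)) , id ]′ (search (suc n))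
  where
  search : ∀ k → (∀ {r} → r < k → ¬ P r) ⊎ (∃ λ r → P r × (∀ {r'} → r' < r → ¬ P r'))
  search zero = inj₁ λ ()
  search (suc k) with search k | P? k
  ... | inj₂ found | _      = inj₂ found
  ... | inj₁ none  | yes pk = inj₂ (k , pk , none)
  ... | inj₁ none  | no ¬pk = inj₁ λ r<1+k → [ none , (λ { refl → ¬pk }) ]′ (m≤n⇒m<n∨m≡n (s≤s⁻¹ r<1+k))

∣-*-split : ∀ {d N r} → 1 ≤ r → d ∣ N * r → ∃₂ λ s t → ∃ λ d' → s * t ≡ r × d' * s ≡ d × d' ∣ N
∣-*-split {d} {N} {r} 1≤r d∣Nr = g , r / g , d / g , trans (*-comm g (r / g)) (m/n*n≡m g∣r) , m/n*n≡m g∣d , d/g∣N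
  where
  g = gcd d r
  g∣d = gcd[m,n]∣m d r
  g∣r = gcd[m,n]∣n d r
  instance
    g≢0 : NonZero g
    g≢0 = ≢-nonZero (gcd[m,n]≢0 d r (inj₂ (≢-sym (<⇒≢ 1≤r))))
  d/g∣N : d / g ∣ N
  d/g∣N = coprime-divisor (coprime-/gcd d r) (subst (d / g ∣_) (*-comm N (r / g)) (*-cancelʳ-∣ g
            (subst₂ _∣_ (sym (m/n*n≡m g∣d)) (trans (cong (N *_) (sym (m/n*n≡m g∣r))) (sym (*-assoc N (r / g) g))) d∣Nr)))

third-index : ∀ {m} → 2 < m → (l j : Fin m) → ∃ λ i → i ≢ l × i ≢ j
third-index (s≤s (s≤s (s≤s _))) zero          zero          = suc zero , (λ ()) , (λ ())
third-index (s≤s (s≤s (s≤s _))) zero          (suc zero)    = suc (suc zero) , (λ ()) , (λ ())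
third-index (s≤s (s≤s (s≤s _))) zero          (suc (suc _)) = suc zero , (λ ()) , (λ ())
third-index (s≤s (s≤s (s≤s _))) (suc zero)    zero          = suc (suc zero) , (λ ()) , (λ ())
third-index (s≤s (s≤s (s≤s _))) (suc zero)    (suc _)       = zero , (λ ()) , (λ ())
third-index (s≤s (s≤s (s≤s _))) (suc (suc _)) zero          = suc zero , (λ ()) , (λ ())
third-index (s≤s (s≤s (s≤s _))) (suc (suc _)) (suc _)       = zero , (λ ()) , (λ ())

module FiniteAbelianGroup {v : ℕ} (_⊕_ : Fin v → Fin v → Fin v) (𝟘 : Fin v) (⊖_ : Fin v → Fin v)
                          (isAbelianGroup : IsAbelianGroup _≡_ _⊕_ 𝟘 ⊖_) where

  G : AbelianGroup _ _
  G = record { isAbelianGroup = isAbelianGroup }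

  open IsAbelianGroup isAbelianGroup using (_-_; assoc; comm; identityˡ; identityʳ; inverseʳ)
  open AbelianGroupProperties G using (⁻¹-involutive; ⁻¹-injective; inverseˡ-unique; inverseʳ-unique;
    ⁻¹-∙-comm; ⁻¹-anti-homo‿-; ε⁻¹≈ε; //-rightDividesˡ; //-rightDividesʳ)
  open CommutativeSemigroupProperties (AbelianGroup.commutativeSemigroup G) using (interchange)
  open MonoidMultiplication (AbelianGroup.monoid G)
    using () renaming (_×_ to _·_; ×-homo-+ to ·-homo-+; ×-homo-1 to ·-homo-1; ×-assocˡ to ·-assocˡ)

  ⊕≡⇒≡- : ∀ {a b x} → a ⊕ b ≡ x → a ≡ x - b
  ⊕≡⇒≡- {a} {b} refl = sym (//-rightDividesʳ b a)

  ≡-⇒⊕≡ : ∀ {a b x} → a ≡ x - b → a ⊕ b ≡ x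
  ≡-⇒⊕≡ {b = b} {x} refl = //-rightDividesˡ b x

  x-𝟘≡x : ∀ x → x - 𝟘 ≡ x
  x-𝟘≡x x = trans (cong (x ⊕_) ε⁻¹≈ε) (identityʳ x)

  -‿⊕-distrib : ∀ x y a b → (x ⊕ y) - (a ⊕ b) ≡ (x - a) ⊕ (y - b)
  -‿⊕-distrib x y a b = trans (cong ((x ⊕ y) ⊕_) (sym (⁻¹-∙-comm a b))) (interchange x y (⊖ a) (⊖ b))

  -‿-‿cancel : ∀ x a b → (x - a) - (x - b) ≡ b - a
  -‿-‿cancel x a b = begin
    (x - a) - (x - b)          ≡⟨ cong ((x - a) ⊕_) (trans (⁻¹-anti-homo‿- x b) (comm b (⊖ x))) ⟩
    (x ⊕ (⊖ a)) ⊕ ((⊖ x) ⊕ b)  ≡⟨ interchange x (⊖ a) (⊖ x) b ⟩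
    (x ⊕ (⊖ x)) ⊕ ((⊖ a) ⊕ b)  ≡⟨ cong (_⊕ ((⊖ a) ⊕ b)) (inverseʳ x) ⟩
    𝟘 ⊕ ((⊖ a) ⊕ b)            ≡⟨ trans (identityˡ _) (comm (⊖ a) b) ⟩
    b - a                      ∎
    where open ≡-Reasoning

  -‿shift : ∀ x c q → x - c ≡ (x - (c ⊕ q)) ⊕ q
  -‿shift x c q = sym (≡-⇒⊕≡ (begin
    x - (c ⊕ q)          ≡⟨ cong (x ⊕_) (sym (⁻¹-∙-comm c q)) ⟩
    x ⊕ ((⊖ c) ⊕ (⊖ q))  ≡⟨ sym (assoc x (⊖ c) (⊖ q)) ⟩
    (x - c) - q          ∎))
    where open ≡-Reasoning

  ·-homo-∸ : ∀ g {i j} → i ≤ j → (j ∸ i) · g ≡ (j · g) - (i · g)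
  ·-homo-∸ g {i} {j} i≤j = ⊕≡⇒≡- (trans (sym (·-homo-+ g (j ∸ i) i)) (cong (_· g) (m∸n+n≡m i≤j)))

  finite-order : ∀ g → ∃ λ n → 1 ≤ n × n · g ≡ 𝟘
  finite-order g with pigeonhole (n<1+n v) (λ (i : Fin (suc v)) → toℕ i · g)
  ... | i , j , i<j , ig≡jg =
    toℕ j ∸ toℕ i , m<n⇒0<n∸m i<j , trans (·-homo-∸ g (<⇒≤ i<j)) (trans (cong (_- (toℕ i · g)) (sym ig≡jg)) (inverseʳ _))

  ⊖-as-multiple : ∀ g → ∃ λ n → n · g ≡ ⊖ g
  ⊖-as-multiple g with finite-order g
  ... | suc n , _ , g⊕ng≡𝟘 = n , inverseʳ-unique g (n · g) g⊕ng≡𝟘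

  -- Convolution of multisets

  infixl 7 _⋆_

  _⋆_ : (Fin v → ℕ) → (Fin v → ℕ) → Fin v → ℕ
  (f ⋆ h) x = sum λ a → f a * sum λ b → h b * δ (a ⊕ b) x

  δ-⊕ : ∀ a b x → δ (a ⊕ b) x ≡ δ a (x - b)
  δ-⊕ a b x = 𝟙-cong ((a ⊕ b) ≟ᶠ x) (a ≟ᶠ (x - b)) ⊕≡⇒≡- ≡-⇒⊕≡

  ∑-⋆-weighted : ∀ f h K → sum (λ y → (f ⋆ h) y * K y) ≡ sum (λ a → f a * sum (λ b → h b * K (a ⊕ b)))
  ∑-⋆-weighted f h K = begin
    sum (λ y → (f ⋆ h) y * K y)
      ≡⟨ ∑-weighted-swap f (λ a y → sum λ b → h b * δ (a ⊕ b) y) K ⟩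
    sum (λ a → f a * sum (λ y → sum (λ b → h b * δ (a ⊕ b) y) * K y))
      ≡⟨ sum-cong-≋ (λ a → cong (f a *_) (inner a)) ⟩
    sum (λ a → f a * sum (λ b → h b * K (a ⊕ b)))  ∎
    where
    open ≡-Reasoning
    inner : ∀ a → sum (λ y → sum (λ b → h b * δ (a ⊕ b) y) * K y) ≡ sum (λ b → h b * K (a ⊕ b))
    inner a = trans (∑-weighted-swap h (λ b y → δ (a ⊕ b) y) K) (sum-cong-≋ λ b → cong (h b *_) (∑-δ (a ⊕ b) K))

  ∑-⋆ : ∀ f h → sum (f ⋆ h) ≡ sum f * sum h
  ∑-⋆ f h = begin
    sum (f ⋆ h)                               ≡⟨ sum-cong-≋ (λ y → sym (*-identityʳ ((f ⋆ h) y))) ⟩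
    sum (λ y → (f ⋆ h) y * 1)                 ≡⟨ ∑-⋆-weighted f h (λ _ → 1) ⟩
    sum (λ a → f a * sum (λ b → h b * 1))     ≡⟨ sum-cong-≋ (λ a → cong (f a *_) (sum-cong-≋ λ b → *-identityʳ (h b))) ⟩
    sum (λ a → f a * sum h)                   ≡⟨ ∑-*ʳ (sum h) f ⟩
    sum f * sum h                             ∎
    where open ≡-Reasoning

  ⋆-cong : ∀ {f f' h h'} → f ≗ f' → h ≗ h' → f ⋆ h ≗ f' ⋆ h'
  ⋆-cong f≗f' h≗h' x = sum-cong-≋ λ a → cong₂ _*_ (f≗f' a) (sum-cong-≋ λ b → cong (_* δ (a ⊕ b) x) (h≗h' b))

  ⋆-comm : ∀ f h → f ⋆ h ≗ h ⋆ f
  ⋆-comm f h x = begin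
    sum (λ a → f a * sum λ b → h b * δ (a ⊕ b) x)     ≡⟨ sum-cong-≋ (λ a → sym (∑-*ˡ (f a) λ b → h b * δ (a ⊕ b) x)) ⟩
    sum (λ a → sum λ b → f a * (h b * δ (a ⊕ b) x))   ≡⟨ ∑-comm (λ a b → f a * (h b * δ (a ⊕ b) x)) ⟩
    sum (λ b → sum λ a → f a * (h b * δ (a ⊕ b) x))   ≡⟨ sum-cong-≋ (λ b → trans (sum-cong-≋ λ a → swap a b) (∑-*ˡ (h b) λ a → f a * δ (b ⊕ a) x)) ⟩
    sum (λ b → h b * sum λ a → f a * δ (b ⊕ a) x)     ∎
    where
    open ≡-Reasoning
    swap : ∀ a b → f a * (h b * δ (a ⊕ b) x) ≡ h b * (f a * δ (b ⊕ a) x)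
    swap a b = trans (x*[y*z]≡y*[x*z] (f a) (h b) _) (cong (λ w → h b * (f a * δ w x)) (comm a b))

  ⋆-assoc : ∀ f h u → (f ⋆ h) ⋆ u ≗ f ⋆ (h ⋆ u)
  ⋆-assoc f h u x = begin
    ((f ⋆ h) ⋆ u) x
      ≡⟨ ∑-⋆-weighted f h (λ y → sum λ c → u c * δ (y ⊕ c) x) ⟩
    sum (λ a → f a * sum λ b → h b * sum λ c → u c * δ ((a ⊕ b) ⊕ c) x)
      ≡⟨ sum-cong-≋ (λ a → cong (f a *_) (sum-cong-≋ λ b → cong (h b *_) (sum-cong-≋ λ c → cong (λ w → u c * δ w x) (assoc a b c)))) ⟩
    sum (λ a → f a * sum λ b → h b * sum λ c → u c * δ (a ⊕ (b ⊕ c)) x)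
      ≡⟨ sum-cong-≋ (λ a → cong (f a *_) (sym (∑-⋆-weighted h u (λ z → δ (a ⊕ z) x)))) ⟩
    (f ⋆ (h ⋆ u)) x  ∎
    where open ≡-Reasoning

  ⋆-interchange : ∀ f g h u → (f ⋆ g) ⋆ (h ⋆ u) ≗ (f ⋆ h) ⋆ (g ⋆ u)
  ⋆-interchange f g h u x = begin
    ((f ⋆ g) ⋆ (h ⋆ u)) x    ≡⟨ ⋆-assoc f g (h ⋆ u) x ⟩
    (f ⋆ (g ⋆ (h ⋆ u))) x    ≡⟨ ⋆-cong {f} (λ _ → refl) inner x ⟩
    (f ⋆ (h ⋆ (g ⋆ u))) x    ≡⟨ ⋆-assoc f h (g ⋆ u) x ⟨
    ((f ⋆ h) ⋆ (g ⋆ u)) x    ∎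
    where
    open ≡-Reasoning
    inner : g ⋆ (h ⋆ u) ≗ h ⋆ (g ⋆ u)
    inner y = begin
      (g ⋆ (h ⋆ u)) y   ≡⟨ ⋆-assoc g h u y ⟨
      ((g ⋆ h) ⋆ u) y   ≡⟨ ⋆-cong {h = u} (⋆-comm g h) (λ _ → refl) y ⟩
      ((h ⋆ g) ⋆ u) y   ≡⟨ ⋆-assoc h g u y ⟩
      (h ⋆ (g ⋆ u)) y   ∎

  δ𝟘-⋆ : ∀ h → δ 𝟘 ⋆ h ≗ h
  δ𝟘-⋆ h x = trans (∑-δ 𝟘 _) (trans (sum-cong-≋ λ b → cong (λ y → h b * δ y x) (identityˡ b)) (∑-δʳ x h))

  ⋆-lower-bound : ∀ f h a b → f a * h b ≤ (f ⋆ h) (a ⊕ b)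
  ⋆-lower-bound f h a b = begin
    f a * h b                                        ≡⟨ cong (f a *_) (sym (trans (cong (h b *_) (δ-refl (a ⊕ b))) (*-identityʳ (h b)))) ⟩
    f a * (h b * δ (a ⊕ b) (a ⊕ b))                  ≤⟨ *-monoʳ-≤ (f a) (term≤∑ (λ b' → h b' * δ (a ⊕ b') (a ⊕ b)) b) ⟩
    f a * sum (λ b' → h b' * δ (a ⊕ b') (a ⊕ b))     ≤⟨ term≤∑ (λ a' → f a' * sum λ b' → h b' * δ (a' ⊕ b') (a ⊕ b)) a ⟩
    (f ⋆ h) (a ⊕ b)                                  ∎
    where open ≤-Reasoning

  ⋆-support : ∀ f h x → 1 ≤ (f ⋆ h) x → ∃₂ λ a b → 1 ≤ f a × 1 ≤ h b × a ⊕ b ≡ x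
  ⋆-support f h x 1≤f⋆h =
    let a , 1≤fa*∑ = positive-term (λ a → f a * sum λ b → h b * δ (a ⊕ b) x) 1≤f⋆h
        1≤fa , 1≤∑ = 1≤m*n⇒1≤m×1≤n (f a) _ 1≤fa*∑
        b , 1≤hb*δ = positive-term (λ b → h b * δ (a ⊕ b) x) 1≤∑
        1≤hb , 1≤δ = 1≤m*n⇒1≤m×1≤n (h b) _ 1≤hb*δ
    in a , b , 1≤fa , 1≤hb , 𝟙-positive ((a ⊕ b) ≟ᶠ x) 1≤δ

  ⋆≡1⇒≤1 : ∀ f h → (∀ x → (f ⋆ h) x ≡ 1) → 1 ≤ sum h → ∀ a → f a ≤ 1
  ⋆≡1⇒≤1 f h f⋆h≡1 1≤∑h a =
    let b , 1≤hb = positive-term h 1≤∑h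
        instance _ = >-nonZero 1≤hb
    in ≤-trans (m≤m*n (f a) (h b)) (≤-trans (⋆-lower-bound f h a b) (≤-reflexive (f⋆h≡1 (a ⊕ b))))

  ∑-⊖ : ∀ F → sum (λ x → F (⊖ x)) ≡ sum F
  ∑-⊖ F = sym (∑-permute F (permutation ⊖_ ⊖_ ⁻¹-involutive ⁻¹-involutive))

  ⋆-⊖ : ∀ f h x → (f ⋆ h) (⊖ x) ≡ ((f ∘ ⊖_) ⋆ (h ∘ ⊖_)) x
  ⋆-⊖ f h x = begin
    sum (λ a → f a * sum λ b → h b * δ (a ⊕ b) (⊖ x))
      ≡⟨ sym (∑-⊖ λ a → f a * sum λ b → h b * δ (a ⊕ b) (⊖ x)) ⟩
    sum (λ a → f (⊖ a) * sum λ b → h b * δ ((⊖ a) ⊕ b) (⊖ x))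
      ≡⟨ sum-cong-≋ (λ a → cong (f (⊖ a) *_) (sym (∑-⊖ λ b → h b * δ ((⊖ a) ⊕ b) (⊖ x)))) ⟩
    sum (λ a → f (⊖ a) * sum λ b → h (⊖ b) * δ ((⊖ a) ⊕ (⊖ b)) (⊖ x))
      ≡⟨ sum-cong-≋ (λ a → cong (f (⊖ a) *_) (sum-cong-≋ λ b → cong (h (⊖ b) *_) (δ-⊖ a b))) ⟩
    sum (λ a → f (⊖ a) * sum λ b → h (⊖ b) * δ (a ⊕ b) x)  ∎
    where
    open ≡-Reasoning
    δ-⊖ : ∀ a b → δ ((⊖ a) ⊕ (⊖ b)) (⊖ x) ≡ δ (a ⊕ b) x
    δ-⊖ a b = trans (cong (λ y → δ y (⊖ x)) (⁻¹-∙-comm a b)) (𝟙-cong (_ ≟ᶠ _) (_ ≟ᶠ _) ⁻¹-injective (cong ⊖_))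

  multiples : Fin v → ℕ → Fin v → ℕ
  multiples g s x = sum {s} λ c → δ (toℕ c · g) x

  ∑-multiples-weighted : ∀ g s K → sum (λ a → multiples g s a * K a) ≡ sum {s} (λ c → K (toℕ c · g))
  ∑-multiples-weighted g s K = begin
    sum (λ a → multiples g s a * K a)                ≡⟨ sum-cong-≋ (λ a → sym (∑-*ʳ (K a) λ (c : Fin s) → δ (toℕ c · g) a)) ⟩
    sum (λ a → sum {s} λ c → δ (toℕ c · g) a * K a)  ≡⟨ ∑-comm (λ a (c : Fin s) → δ (toℕ c · g) a * K a) ⟩
    sum {s} (λ c → sum λ a → δ (toℕ c · g) a * K a)  ≡⟨ sum-cong-≋ (λ (c : Fin s) → ∑-δ (toℕ c · g) K) ⟩
    sum {s} (λ c → K (toℕ c · g))                    ∎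
    where open ≡-Reasoning

  ∑-multiples : ∀ g s → sum (multiples g s) ≡ s
  ∑-multiples g s = begin
    sum (multiples g s)                  ≡⟨ sum-cong-≋ (λ a → sym (*-identityʳ (multiples g s a))) ⟩
    sum (λ a → multiples g s a * 1)      ≡⟨ ∑-multiples-weighted g s (λ _ → 1) ⟩
    sum {s} (λ _ → 1)                    ≡⟨ ∑-one s ⟩
    s                                    ∎
    where open ≡-Reasoning

  ⋆-multiples : ∀ F g s x → (F ⋆ multiples g s) x ≡ sum {s} λ c → F (x - toℕ c · g)
  ⋆-multiples F g s x = begin
    (F ⋆ multiples g s) x
      ≡⟨ ⋆-comm F (multiples g s) x ⟩
    sum (λ a → multiples g s a * sum λ b → F b * δ (a ⊕ b) x)
      ≡⟨ ∑-multiples-weighted g s (λ a → sum λ b → F b * δ (a ⊕ b) x) ⟩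
    sum {s} (λ c → sum λ b → F b * δ ((toℕ c · g) ⊕ b) x)
      ≡⟨ sum-cong-≋ (λ (c : Fin s) → trans (sum-cong-≋ λ b → cong (F b *_) (shift (toℕ c · g) b)) (∑-δʳ (x - toℕ c · g) F)) ⟩
    sum {s} (λ c → F (x - toℕ c · g))  ∎
    where
    open ≡-Reasoning
    shift : ∀ a b → δ (a ⊕ b) x ≡ δ b (x - a)
    shift a b = trans (cong (λ w → δ w x) (comm a b)) (δ-⊕ b a x)

  multiples⋆multiples : ∀ g s g' t x →
    (multiples g s ⋆ multiples g' t) x ≡ sum {s} λ i → sum {t} λ j → δ ((toℕ i · g) ⊕ (toℕ j · g')) x
  multiples⋆multiples g s g' t x =
    trans (∑-multiples-weighted g s _) (sum-cong-≋ λ (i : Fin s) → ∑-multiples-weighted g' t (λ b → δ ((toℕ i · g) ⊕ b) x))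

  multiples-split : ∀ g s t → multiples g (s * t) ≗ multiples g s ⋆ multiples (s · g) t
  multiples-split g s t x = begin
    sum {s * t} (λ c → δ (toℕ c · g) x)
      ≡⟨ cong (λ n → sum {n} λ c → δ (toℕ c · g) x) (*-comm s t) ⟩
    sum {t * s} (λ c → δ (toℕ c · g) x)
      ≡⟨ ∑-combine t (λ c → δ (toℕ c · g) x) ⟩
    sum {t} (λ j → sum {s} λ i → δ (toℕ (combine j i) · g) x)
      ≡⟨ ∑-comm (λ (j : Fin t) (i : Fin s) → δ (toℕ (combine j i) · g) x) ⟩
    sum {s} (λ i → sum {t} λ j → δ (toℕ (combine j i) · g) x)
      ≡⟨ sum-cong-≋ (λ (i : Fin s) → sum-cong-≋ λ (j : Fin t) → cong (λ w → δ w x) (combine-multiple i j)) ⟩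
    sum {s} (λ i → sum {t} λ j → δ ((toℕ i · g) ⊕ (toℕ j · (s · g))) x)
      ≡⟨ multiples⋆multiples g s (s · g) t x ⟨
    (multiples g s ⋆ multiples (s · g) t) x  ∎
    where
    open ≡-Reasoning
    combine-multiple : ∀ (i : Fin s) (j : Fin t) → toℕ (combine j i) · g ≡ (toℕ i · g) ⊕ (toℕ j · (s · g))
    combine-multiple i j = begin
      toℕ (combine j i) · g              ≡⟨ cong (_· g) (trans (toℕ-combine j i) (cong (_+ toℕ i) (*-comm s (toℕ j)))) ⟩
      (toℕ j * s + toℕ i) · g            ≡⟨ ·-homo-+ g (toℕ j * s) (toℕ i) ⟩
      ((toℕ j * s) · g) ⊕ (toℕ i · g)    ≡⟨ cong (_⊕ (toℕ i · g)) (sym (·-assocˡ g (toℕ j) s)) ⟩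
      (toℕ j · (s · g)) ⊕ (toℕ i · g)    ≡⟨ comm _ _ ⟩
      (toℕ i · g) ⊕ (toℕ j · (s · g))    ∎

  -- Factorisations along a subgroup chain

  record IsSubmonoid (F : Fin v → ℕ) : Set where
    field
      ≤1       : ∀ x → F x ≤ 1
      𝟘∈       : F 𝟘 ≡ 1
      ⊕-closed : ∀ {x y} → F x ≡ 1 → F y ≡ 1 → F (x ⊕ y) ≡ 1

    ·-closed : ∀ {x} n → F x ≡ 1 → F (n · x) ≡ 1
    ·-closed zero    _  = 𝟘∈
    ·-closed (suc n) x∈ = ⊕-closed x∈ (·-closed n x∈)

    ⊖-closed : ∀ {x} → F x ≡ 1 → F (⊖ x) ≡ 1
    ⊖-closed {x} x∈ = let n , nx≡⊖x = ⊖-as-multiple x in subst (λ y → F y ≡ 1) nx≡⊖x (·-closed n x∈)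

    -‿closed : ∀ {x y} → F x ≡ 1 → F y ≡ 1 → F (x - y) ≡ 1
    -‿closed x∈ y∈ = ⊕-closed x∈ (⊖-closed y∈)

  module Adjoin {F : Fin v → ℕ} (H : IsSubmonoid F) (g : Fin v) where
    open IsSubmonoid H

    -- r is the order of g modulo H, i.e. the index of H in H + ⟨g⟩.
    private
      minimal : ∃ λ r → (1 ≤ r × F (r · g) ≡ 1) × (∀ {r'} → r' < r → ¬ (1 ≤ r' × F (r' · g) ≡ 1))
      minimal = let n , 1≤n , ng≡𝟘 = finite-order g in
        least (λ r → (1 ≤? r) ×-dec (F (r · g) ≟ 1)) (1≤n , trans (cong F ng≡𝟘) 𝟘∈)

    r : ℕ
    r = proj₁ minimal

    1≤r : 1 ≤ r
    1≤r = proj₁ (proj₁ (proj₂ minimal))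

    instance
      r≢0 : NonZero r
      r≢0 = >-nonZero 1≤r

    rg∈ : F (r · g) ≡ 1
    rg∈ = proj₂ (proj₁ (proj₂ minimal))

    F' : Fin v → ℕ
    F' = F ⋆ multiples g r

    private
      cosets-disjoint : ∀ x {i j} → i < j → j < r → F (x - i · g) ≡ 1 → F (x - j · g) ≡ 1 → ⊥
      cosets-disjoint x {i} {j} i<j j<r ∈i ∈j = proj₂ (proj₂ minimal) (≤-<-trans (m∸n≤m j i) j<r) (m<n⇒0<n∸m i<j ,
        subst (λ y → F y ≡ 1) (trans (-‿-‿cancel x (i · g) (j · g)) (sym (·-homo-∸ g (<⇒≤ i<j)))) (-‿closed ∈i ∈j))

    F'≤1 : ∀ x → F' x ≤ 1
    F'≤1 x = subst (_≤ 1) (sym (⋆-multiples F g r x)) (∑≤1 _ (λ c → ≤1 _) unique)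
      where
      unique : ∀ (c c' : Fin r) → F (x - toℕ c · g) ≡ 1 → F (x - toℕ c' · g) ≡ 1 → c ≡ c'
      unique c c' ∈c ∈c' with <-cmpᶠ c c'
      ... | tri< c<c' _ _ = ⊥-elim (cosets-disjoint x c<c' (toℕ<n c') ∈c ∈c')
      ... | tri≈ _ c≡c' _ = c≡c'
      ... | tri> _ _ c>c' = ⊥-elim (cosets-disjoint x c>c' (toℕ<n c) ∈c' ∈c)

    ∈F'⇐ : ∀ x c → F (x - c · g) ≡ 1 → F' x ≡ 1
    ∈F'⇐ x c ∈c = ≤-antisym (F'≤1 x) (begin
      1                                           ≡⟨ sym ∈c%r ⟩
      F (x - toℕ (fromℕ< (m%n<n c r)) · g)        ≤⟨ term≤∑ (λ (c' : Fin r) → F (x - toℕ c' · g)) (fromℕ< (m%n<n c r)) ⟩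
      sum {r} (λ c' → F (x - toℕ c' · g))         ≡⟨ sym (⋆-multiples F g r x) ⟩
      F' x                                        ∎)
      where
      open ≤-Reasoning
      cg≡ : c · g ≡ ((c % r) · g) ⊕ ((c / r) · (r · g))
      cg≡ = trans (cong (_· g) (m≡m%n+[m/n]*n c r)) (trans (·-homo-+ g (c % r) _) (cong (((c % r) · g) ⊕_) (sym (·-assocˡ g (c / r) r))))
      ∈c%r : F (x - toℕ (fromℕ< (m%n<n c r)) · g) ≡ 1
      ∈c%r = subst (λ n → F (x - n · g) ≡ 1) (sym (toℕ-fromℕ< (m%n<n c r)))
        (subst (λ y → F y ≡ 1) (sym (-‿shift x ((c % r) · g) ((c / r) · (r · g))))
          (⊕-closed (subst (λ y → F (x - y) ≡ 1) cg≡ ∈c) (·-closed (c / r) rg∈)))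

    ∈F'⇒ : ∀ x → F' x ≡ 1 → ∃ λ c → F (x - c · g) ≡ 1
    ∈F'⇒ x ∈x = let c , 1≤ = positive-term (λ (c : Fin r) → F (x - toℕ c · g)) (subst (1 ≤_) (trans (sym ∈x) (⋆-multiples F g r x)) ≤-refl)
                in toℕ c , ≤-antisym (≤1 _) 1≤

    F⊆F' : ∀ {x} → F x ≡ 1 → F' x ≡ 1
    F⊆F' {x} ∈x = ∈F'⇐ x 0 (subst (λ y → F y ≡ 1) (sym (x-𝟘≡x x)) ∈x)

    g∈F' : F' g ≡ 1
    g∈F' = ∈F'⇐ g 1 (subst (λ y → F y ≡ 1) (sym (trans (cong (g -_) (·-homo-1 g)) (inverseʳ g))) 𝟘∈)

    F'-isSubmonoid : IsSubmonoid F'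
    F'-isSubmonoid = record
      { ≤1       = F'≤1
      ; 𝟘∈       = F⊆F' 𝟘∈
      ; ⊕-closed = λ {x} {y} ∈x ∈y →
          let c₁ , ∈c₁ = ∈F'⇒ x ∈x ; c₂ , ∈c₂ = ∈F'⇒ y ∈y in
          ∈F'⇐ (x ⊕ y) (c₁ + c₂) (subst (λ z → F z ≡ 1)
            (sym (trans (cong ((x ⊕ y) -_) (·-homo-+ g c₁ c₂)) (-‿⊕-distrib x y (c₁ · g) (c₂ · g))))
            (⊕-closed ∈c₁ ∈c₂))
      }

  Factorisable : (Fin v → ℕ) → Set
  Factorisable F = ∀ d → d ∣ sum F → ∃₂ λ A B → A ⋆ B ≗ F × sum A ≡ d

  factorisable-⋆-multiples : ∀ {F} g {r} → 1 ≤ r → Factorisable F → Factorisable (F ⋆ multiples g r)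
  factorisable-⋆-multiples {F} g {r} 1≤r factorisable d d∣
    with ∣-*-split 1≤r (subst (d ∣_) (trans (∑-⋆ F (multiples g r)) (cong (sum F *_) (∑-multiples g r))) d∣)
  ... | s , t , d' , st≡r , d's≡d , d'∣∑F with factorisable d' d'∣∑F
  ... | A , B , A⋆B≗F , ∑A≡d' = A ⋆ multiples g s , B ⋆ multiples (s · g) t , split , ∑A⋆M≡d
    where
    open ≡-Reasoning
    split : (A ⋆ multiples g s) ⋆ (B ⋆ multiples (s · g) t) ≗ F ⋆ multiples g r
    split x = begin
      ((A ⋆ multiples g s) ⋆ (B ⋆ multiples (s · g) t)) x   ≡⟨ ⋆-interchange A (multiples g s) B (multiples (s · g) t) x ⟩
      ((A ⋆ B) ⋆ (multiples g s ⋆ multiples (s · g) t)) x   ≡⟨ ⋆-cong A⋆B≗F (λ y → sym (multiples-split g s t y)) x ⟩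
      (F ⋆ multiples g (s * t)) x                           ≡⟨ cong (λ n → (F ⋆ multiples g n) x) st≡r ⟩
      (F ⋆ multiples g r) x                                 ∎
    ∑A⋆M≡d : sum (A ⋆ multiples g s) ≡ d
    ∑A⋆M≡d = trans (∑-⋆ A (multiples g s)) (trans (cong₂ _*_ ∑A≡d' (∑-multiples g s)) d's≡d)

  record FactorisableSubgroup : Set where
    field
      indicator    : Fin v → ℕ
      isSubmonoid  : IsSubmonoid indicator
      factorisable : Factorisable indicator

  open FactorisableSubgroup using (indicator)

  trivial : FactorisableSubgroup
  trivial = record
    { indicator    = δ 𝟘
    ; isSubmonoid  = record
      { ≤1       = λ x → 𝟙≤1 (𝟘 ≟ᶠ x)
      ; 𝟘∈       = δ-refl 𝟘
      ; ⊕-closed = λ x∈ y∈ → subst (λ z → δ 𝟘 z ≡ 1) (trans (sym (identityʳ 𝟘)) (cong₂ _⊕_ (δ≡1⇒≡ x∈) (δ≡1⇒≡ y∈))) (δ-refl 𝟘)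
      }
    ; factorisable = λ d d∣1 → δ 𝟘 , δ 𝟘 , δ𝟘-⋆ (δ 𝟘) , trans (∑-δ-one 𝟘) (sym (∣1⇒≡1 (subst (d ∣_) (∑-δ-one 𝟘) d∣1)))
    }

  adjoin : (S : FactorisableSubgroup) (g : Fin v) →
           Σ FactorisableSubgroup λ S' → indicator S' g ≡ 1 × (∀ {x} → indicator S x ≡ 1 → indicator S' x ≡ 1)
  adjoin S g = record
    { indicator    = F'
    ; isSubmonoid  = F'-isSubmonoid
    ; factorisable = factorisable-⋆-multiples g 1≤r (FactorisableSubgroup.factorisable S)
    } , g∈F' , F⊆F'
    where open Adjoin (FactorisableSubgroup.isSubmonoid S) g

  generated-by : (xs : List (Fin v)) → Σ FactorisableSubgroup λ S → All (λ x → indicator S x ≡ 1) xs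
  generated-by []       = trivial , []
  generated-by (y ∷ ys) =
    let S , ys∈S = generated-by ys ; S' , y∈S' , S⊆S' = adjoin S y in S' , y∈S' ∷ All.map S⊆S' ys∈S

  whole-group : Σ FactorisableSubgroup λ S → ∀ x → indicator S x ≡ 1
  whole-group = let S , all∈S = generated-by (allFin v) in S , λ x → All.lookup all∈S (∈-allFin x)

  factorisation : ∀ d → d ∣ v → ∃₂ λ A B → (∀ x → (A ⋆ B) x ≡ 1) × sum A ≡ d
  factorisation d d∣v =
    let S , everything = whole-group
        A , B , A⋆B≗S , ∑A≡d = FactorisableSubgroup.factorisable S d
                                 (subst (d ∣_) (sym (trans (sum-cong-≋ everything) (∑-one v))) d∣v)
    in A , B , (λ x → trans (A⋆B≗S x) (everything x)) , ∑A≡d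

  -- Difference multisets

  -- Δ S T g is the number of pairs (a , b) ∈ S × T with a - b ≡ g.
  Δ : Subset v → Subset v → Fin v → ℕ
  Δ S T = 𝟙ˢ S ⋆ (𝟙ˢ T ∘ ⊖_)

  Δ-as-pairs : ∀ S T g → Δ S T g ≡ sum λ a → sum λ b → 𝟙ˢ S a * (𝟙ˢ T b * δ (a - b) g)
  Δ-as-pairs S T g = sum-cong-≋ λ a → trans (cong (𝟙ˢ S a *_) (inner a)) (sym (∑-*ˡ (𝟙ˢ S a) λ b → 𝟙ˢ T b * δ (a - b) g))
    where
    inner : ∀ a → sum (λ b → 𝟙ˢ T (⊖ b) * δ (a ⊕ b) g) ≡ sum λ b → 𝟙ˢ T b * δ (a - b) g
    inner a = trans (sum-cong-≋ λ b → cong (λ y → 𝟙ˢ T (⊖ b) * δ (a ⊕ y) g) (sym (⁻¹-involutive b)))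
                    (∑-⊖ λ b → 𝟙ˢ T b * δ (a - b) g)

  Δ-swap : ∀ S T g → Δ S T g ≡ Δ T S (⊖ g)
  Δ-swap S T g = sym (begin
    Δ T S (⊖ g)                                ≡⟨ ⋆-⊖ (𝟙ˢ T) (𝟙ˢ S ∘ ⊖_) g ⟩
    ((𝟙ˢ T ∘ ⊖_) ⋆ (𝟙ˢ S ∘ ⊖_ ∘ ⊖_)) g         ≡⟨ ⋆-cong {𝟙ˢ T ∘ ⊖_} (λ _ → refl) (λ x → cong (𝟙ˢ S) (⁻¹-involutive x)) g ⟩
    ((𝟙ˢ T ∘ ⊖_) ⋆ 𝟙ˢ S) g                     ≡⟨ ⋆-comm (𝟙ˢ T ∘ ⊖_) (𝟙ˢ S) g ⟩
    Δ S T g                                    ∎)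
    where open ≡-Reasoning

  ∑-Δ : ∀ S T → sum (Δ S T) ≡ ∣ S ∣ * ∣ T ∣
  ∑-Δ S T = trans (∑-⋆ (𝟙ˢ S) (𝟙ˢ T ∘ ⊖_)) (cong₂ _*_ (sym (∣S∣≡∑𝟙ˢ S)) (trans (∑-⊖ (𝟙ˢ T)) (sym (∣S∣≡∑𝟙ˢ T))))

  Δ-lower-bound : ∀ {S T a b} → a ∈ S → b ∈ T → 1 ≤ Δ S T (a - b)
  Δ-lower-bound {S} {T} {a} {b} a∈S b∈T = subst (_≤ Δ S T (a - b))
    (cong₂ _*_ (𝟙-yes (a ∈? S) a∈S) (trans (cong (𝟙ˢ T) (⁻¹-involutive b)) (𝟙-yes (b ∈? T) b∈T)))
    (⋆-lower-bound (𝟙ˢ S) (𝟙ˢ T ∘ ⊖_) a (⊖ b))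

  Δ-𝟘 : ∀ S T → 1 ≤ Δ S T 𝟘 → ∃ λ y → y ∈ S × y ∈ T
  Δ-𝟘 S T 1≤Δ =
    let a , b , a∈S , ⊖b∈T , a⊕b≡𝟘 = ⋆-support (𝟙ˢ S) (𝟙ˢ T ∘ ⊖_) 𝟘 1≤Δ
    in a , 𝟙-positive (a ∈? S) a∈S , subst (_∈ T) (sym (inverseˡ-unique a b a⊕b≡𝟘)) (𝟙-positive ((⊖ b) ∈? T) ⊖b∈T)

  module Multiplicity {m} (A : Fin m → Subset v) (i : Fin m) (g : Fin v) where

    -- The summands of multiplicity live in its where block; unification recovers them here.
    mutual
      term : Fin m → ℕ
      term = _

      multiplicity≡∑ : multiplicity _⊕_ ⊖_ A i g ≡ sum term
      multiplicity≡∑ = sumFin≡∑ m term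

    mutual
      pair-count : Fin m → Fin v → Fin v → ℕ
      pair-count = _

      term-≢-unfold : ∀ {j} → j ≢ i → term j ≡ sumFin v λ a → sumFin v λ b → pair-count j a b
      term-≢-unfold {j} j≢i with j ≟ᶠ i
      ... | yes j≡i = ⊥-elim (j≢i j≡i)
      ... | no  _   = refl

    pair-count≡ : ∀ j a b → pair-count j a b ≡ 𝟙ˢ (A i) a * (𝟙ˢ (A j) b * δ (a - b) g)
    pair-count≡ j a b with a ∈? A i | b ∈? A j | (a - b) ≟ᶠ g
    ... | yes _ | yes _ | yes _ = refl
    ... | yes _ | yes _ | no  _ = refl
    ... | yes _ | no  _ | _     = refl
    ... | no  _ | _     | _     = refl

    term-≡ : term i ≡ 0
    term-≡ with i ≟ᶠ i
    ... | yes _  = refl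
    ... | no i≢i = ⊥-elim (i≢i refl)

    1≤term⇒≢ : ∀ {j} → 1 ≤ term j → j ≢ i
    1≤term⇒≢ 1≤term refl = contradiction (≤-trans 1≤term (≤-reflexive term-≡)) λ ()

    term-≢ : ∀ {j} → j ≢ i → term j ≡ Δ (A i) (A j) g
    term-≢ {j} j≢i = begin
      term j                                                        ≡⟨ term-≢-unfold j≢i ⟩
      sumFin v (λ a → sumFin v λ b → pair-count j a b)              ≡⟨ sumFin≡∑ v _ ⟩
      sum (λ a → sumFin v λ b → pair-count j a b)                   ≡⟨ sum-cong-≋ (λ a → trans (sumFin≡∑ v _) (sum-cong-≋ (pair-count≡ j a))) ⟩
      sum (λ a → sum λ b → 𝟙ˢ (A i) a * (𝟙ˢ (A j) b * δ (a - b) g)) ≡⟨ sym (Δ-as-pairs (A i) (A j) g) ⟩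
      Δ (A i) (A j) g                                               ∎
      where open ≡-Reasoning

  module _ {m k} {A : Fin m → Subset v} (1≤k : 1 ≤ k) (sedf : IsNonDisjointSEDF v m k 1 _⊕_ ⊖_ A) where
    open Multiplicity A

    private
      ∑term≡1 : ∀ i g → sum (term i g) ≡ 1
      ∑term≡1 i g = trans (sym (multiplicity≡∑ i g)) (proj₂ sedf i g)

    intersecting-partner : ∀ l → ∃ λ j → j ≢ l × ∃ λ y → y ∈ A l × y ∈ A j
    intersecting-partner l =
      let j , 1≤term = positive-term (term l 𝟘) (≤-reflexive (sym (∑term≡1 l 𝟘)))
          j≢l = 1≤term⇒≢ l 𝟘 1≤term
      in j , j≢l , Δ-𝟘 (A l) (A j) (subst (1 ≤_) (term-≢ l 𝟘 j≢l) 1≤term)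

    no-third-set : ∀ {i l j} → i ≢ l → i ≢ j → l ≢ j → ∀ {y} → y ∈ A l → y ∈ A j → ⊥
    no-third-set {i} {l} {j} i≢l i≢j l≢j {y} y∈l y∈j =
      let a , a∈i = nonempty (A i) (subst (1 ≤_) (sym (proj₁ sedf i)) 1≤k)
          two≤terms = +-mono-≤ (subst (1 ≤_) (sym (term-≢ i (a - y) (i≢l ∘ sym))) (Δ-lower-bound a∈i y∈l))
                               (subst (1 ≤_) (sym (term-≢ i (a - y) (i≢j ∘ sym))) (Δ-lower-bound a∈i y∈j))
      in contradiction (≤-trans two≤terms (≤-trans (terms≤∑ (term i (a - y)) l≢j) (≤-reflexive (∑term≡1 i (a - y))))) λ { (s≤s ()) }

    at-most-two : m ≤ 2
    at-most-two = ≮⇒≥ λ 2<m →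
      let l = fromℕ< (≤-trans (s≤s z≤n) 2<m)
          j , j≢l , y , y∈l , y∈j = intersecting-partner l
          i , i≢l , i≢j = third-index 2<m l j
      in no-third-set i≢l i≢j (j≢l ∘ sym) y∈l y∈j

  multiplicity-pair₀ : ∀ (A : Fin 2 → Subset v) g → multiplicity _⊕_ ⊖_ A zero g ≡ Δ (A zero) (A (suc zero)) g
  multiplicity-pair₀ A g = trans (multiplicity≡∑ zero g) (trans (cong₂ _+_ (term-≡ zero g) (cong (_+ 0) (term-≢ zero g λ ()))) (+-identityʳ _))
    where open Multiplicity A

  multiplicity-pair₁ : ∀ (A : Fin 2 → Subset v) g → multiplicity _⊕_ ⊖_ A (suc zero) g ≡ Δ (A zero) (A (suc zero)) (⊖ g)
  multiplicity-pair₁ A g = trans (multiplicity≡∑ (suc zero) g)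
    (trans (cong₂ _+_ (term-≢ (suc zero) g λ ()) (cong (_+ 0) (term-≡ (suc zero) g))) (trans (+-identityʳ _) (Δ-swap (A (suc zero)) (A zero) g)))
    where open Multiplicity A

  pair-SEDF⇒square : ∀ {k} (A : Fin 2 → Subset v) → IsNonDisjointSEDF v 2 k 1 _⊕_ ⊖_ A → v ≡ k * k
  pair-SEDF⇒square {k} A (cards , multiplicity≡1) = begin
    v                                  ≡⟨ sym (∑-one v) ⟩
    sum {v} (λ _ → 1)                  ≡⟨ sum-cong-≋ (λ g → trans (sym (multiplicity≡1 zero g)) (multiplicity-pair₀ A g)) ⟩
    sum (Δ (A zero) (A (suc zero)))    ≡⟨ ∑-Δ (A zero) (A (suc zero)) ⟩
    ∣ A zero ∣ * ∣ A (suc zero) ∣      ≡⟨ cong₂ _*_ (cards zero) (cards (suc zero)) ⟩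
    k * k                              ∎
    where open ≡-Reasoning

  pair : Subset v → Subset v → Fin 2 → Subset v
  pair S T zero       = S
  pair S T (suc zero) = T

  factorisation⇒pair-SEDF : ∀ {k A B} → (∀ x → (A ⋆ B) x ≡ 1) → sum A ≡ k → sum B ≡ k → 1 ≤ k →
                            IsNonDisjointSEDF v 2 k 1 _⊕_ ⊖_ (pair (support A) (support (B ∘ ⊖_)))
  factorisation⇒pair-SEDF {k} {A} {B} A⋆B≡1 ∑A≡k ∑B≡k 1≤k = cards , multiplicity≡1
    where
    A≤1 : ∀ x → A x ≤ 1
    A≤1 = ⋆≡1⇒≤1 A B A⋆B≡1 (subst (1 ≤_) (sym ∑B≡k) 1≤k)
    B≤1 : ∀ x → B x ≤ 1
    B≤1 = ⋆≡1⇒≤1 B A (λ x → trans (⋆-comm B A x) (A⋆B≡1 x)) (subst (1 ≤_) (sym ∑A≡k) 1≤k)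
    S T : Subset v
    S = support A
    T = support (B ∘ ⊖_)
    Δ≡1 : ∀ g → Δ S T g ≡ 1
    Δ≡1 g = trans (⋆-cong (𝟙ˢ-support A A≤1) (λ x → trans (𝟙ˢ-support (B ∘ ⊖_) (B≤1 ∘ ⊖_) (⊖ x)) (cong B (⁻¹-involutive x))) g)
                  (A⋆B≡1 g)
    cards : ∀ i → ∣ pair S T i ∣ ≡ k
    cards zero       = trans (∣support∣ A A≤1) ∑A≡k
    cards (suc zero) = trans (∣support∣ (B ∘ ⊖_) (B≤1 ∘ ⊖_)) (trans (∑-⊖ B) ∑B≡k)
    multiplicity≡1 : ∀ i g → multiplicity _⊕_ ⊖_ (pair S T) i g ≡ 1
    multiplicity≡1 zero       g = trans (multiplicity-pair₀ (pair S T) g) (Δ≡1 g)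
    multiplicity≡1 (suc zero) g = trans (multiplicity-pair₁ (pair S T) g) (Δ≡1 (⊖ g))

  square⇒pair-SEDF : ∀ {k} → 1 ≤ k → v ≡ k * k → NonDisjointSEDFExists v 2 k 1 _⊕_ ⊖_
  square⇒pair-SEDF {k} 1≤k v≡k*k =
    let A , B , A⋆B≡1 , ∑A≡k = factorisation k (divides k v≡k*k)
        instance _ = >-nonZero 1≤k
        ∑B≡k = *-cancelˡ-≡ (sum B) k k (begin
          k * sum B          ≡⟨ cong (_* sum B) (sym ∑A≡k) ⟩
          sum A * sum B      ≡⟨ sym (∑-⋆ A B) ⟩
          sum (A ⋆ B)        ≡⟨ sum-cong-≋ A⋆B≡1 ⟩
          sum {v} (λ _ → 1)  ≡⟨ ∑-one v ⟩
          v                  ≡⟨ v≡k*k ⟩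
          k * k              ∎)
    in _ , factorisation⇒pair-SEDF A⋆B≡1 ∑A≡k ∑B≡k 1≤k
    where open ≡-Reasoning

mainTheorem6 : (v m k : ℕ)
               (_⊕_ : Fin v → Fin v → Fin v) (𝟘 : Fin v) (⊖_ : Fin v → Fin v) →
               IsAbelianGroup _≡_ _⊕_ 𝟘 ⊖_ →
               1 < m → 1 ≤ k →
               NonDisjointSEDFExists v m k 1 _⊕_ ⊖_ ⇔ (m ≡ 2 × v ≡ k * k)
mainTheorem6 v m k _⊕_ 𝟘 ⊖_ isAbelianGroup 1<m 1≤k = mk⇔ necessary sufficient
  where
  open FiniteAbelianGroup _⊕_ 𝟘 ⊖_ isAbelianGroup
  necessary : NonDisjointSEDFExists v m k 1 _⊕_ ⊖_ → m ≡ 2 × v ≡ k * k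
  necessary (A , sedf) = m≡2 , square m≡2 A sedf
    where
    m≡2 : m ≡ 2
    m≡2 = ≤-antisym (at-most-two 1≤k sedf) 1<m
    square : ∀ {m} → m ≡ 2 → (A : Fin m → Subset v) → IsNonDisjointSEDF v m k 1 _⊕_ ⊖_ A → v ≡ k * k
    square refl = pair-SEDF⇒square
  sufficient : m ≡ 2 × v ≡ k * k → NonDisjointSEDFExists v m k 1 _⊕_ ⊖_
  sufficient (refl , v≡k*k) = square⇒pair-SEDF 1≤k v≡k*k
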